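{- Let $c\ge 2$, $1\le s\le c-1$ and let $n$ be a positive integer. Suppose $\lambda$ is an integer with $\lambda\equiv sn\pmod c$ and $1\le\lambda\le\min\{s,c-s\}$, and suppose $q>c-\lambda$. Then $f^q_{c,s}(n)\le q^{\lceil sn/c\rceil}$.
   Context: $[m]=\{1,\dots,m\}$. A code $\mathcal{C}\subseteq[q]^n$ is $(c,s)$-frameproof if for every $c+1$ codewords $\bm x^0,\dots,\bm x^c\in\mathcal{C}$ with $\bm x^0\neq\bm x^j$ for each $j\in[c]$ ($\bm x^1,\dots,\bm x^c$ not necessarily distinct), there is a coordinate $i\in[n]$ with $|\{j\in[c]:x^j_i=x^0_i\}|<s$. $f^q_{c,s}(n)$ is the maximum size of a $(c,s)$-frameproof code in $[q]^n$. -}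

module Defs where

open import Data.Nat using (ℕ; _<_)
open import Data.Fin using (Fin)
open import Data.Vec using (Vec; lookup)
open import Data.Fin.Properties using (_≟_)
open import Data.List using (List; length; filter; allFin)
open import Data.List.Membership.Propositional using (_∈_)
open import Data.List.Relation.Unary.Unique.Propositional using (Unique)
open import Data.Product using (∃; _×_)
open import Relation.Binary.PropositionalEquality using (_≡_)
open import Relation.Nullary using (¬_)

Word : ℕ → ℕ → Set
Word q n = Vec (Fin q) n

agreeCount : ∀ {q n c} → Word q n → (Fin c → Word q n) → Fin n → ℕ
agreeCount {c = c} x0 xs i = length (filter (λ j → lookup (xs j) i ≟ lookup x0 i) (allFin c))

-- A code is a duplicate-free list of words; its size is its length.
-- (c,s)-frameproof: for every x0 ∈ C and every x1..xc ∈ C (not necessarily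
-- distinct) with x0 ≠ xj for all j, some coordinate i has fewer than s
-- indices j with xj_i = x0_i.
IsFrameproof : ∀ {q n} → ℕ → ℕ → List (Word q n) → Set
IsFrameproof {q} {n} c s C =
  (x0 : Word q n) → x0 ∈ C →
  (xs : Fin c → Word q n) → (∀ j → xs j ∈ C) → (∀ j → ¬ (x0 ≡ xs j)) →
  ∃ λ (i : Fin n) → agreeCount x0 xs i < s

module Submission where

-- Write s·n = λ′ + t·c and w = c − λ′, so that ⌈s·n/c⌉ = t + 1.  Call a codeword x determined on a
-- coordinate set S if no other codeword agrees with x on S.  Choose T with |T| ≤ t on which the largest
-- number a of codewords is determined, and extend it to L ⊇ T with |L| = t + 1.  Arranging the coordinates
-- cyclically into w columns of size at most t, the λ′ copies of L together with the columns cover every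
-- coordinate s times.  A codeword determined on none of these c sets would be framed by c codewords agreeing
-- with it on them, so every codeword is determined on T, or on L but not on T (b of these), or on a column;
-- hence |C| ≤ a + b + w·a.  The cylinders fixing the codewords of the first kind on T and those of the second
-- kind on L are pairwise disjoint, so a·q^(n−|T|) + b·q^(n−t−1) ≤ qⁿ, i.e. q·a + b ≤ q^(t+1), and w < q
-- gives |C| ≤ q^(t+1).

open import Defs
open import Data.Bool using (true; false; if_then_else_)
open import Data.Bool.Properties using (if-float)
open import Data.Fin as Fin using (Fin; zero; suc; toℕ; fromℕ<; splitAt; join; punchOut)
open import Data.Fin.Properties as Fin
  using (injective⇒≤; splitAt-join; join-splitAt; suc-injective; punchOut-injective; toℕ<n; toℕ-fromℕ<; toℕ-injective)
open import Data.Fin.Subset using (Subset; Side; inside; outside; _∈_; _⊆_; ∁; ∣_∣; ⊤; ⊥)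
open import Data.Fin.Subset.Properties using (_∈?_; ⊆-refl; s⊆s; ⊆⊤; ∣⊤∣≡n; ∣⊥∣≡0; ∣∁p∣≡n∸∣p∣; ∣p∣≤n)
open import Data.List using (List; []; _∷_; [_]; length; filter; allFin; map; concatMap) renaming (_++_ to _++ˡ_)
open import Data.List.Extrema.Nat using (argmax; argmax-all; f[xs]≤f[argmax])
open import Data.List.Membership.Propositional using (find; lose) renaming (_∈_ to _∈ˡ_)
open import Data.List.Membership.Propositional.Properties
  using (∈-filter⁺; ∈-filter⁻; ∈-allFin; ∈-++⁺ˡ; ∈-++⁺ʳ; ∈-map⁺)
open import Data.List.Membership.Setoid.Properties using (index-injective)
open import Data.List.Properties using (map-++)
open import Data.List.Relation.Unary.All as All using (All; []; _∷_)
import Data.List.Relation.Unary.All.Properties as All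
open import Data.List.Relation.Unary.AllPairs as AllPairs using (AllPairs; []; _∷_)
import Data.List.Relation.Unary.AllPairs.Properties as AllPairs
open import Data.List.Relation.Unary.Any as Anyˡ using (Any)
open import Data.List.Relation.Unary.Unique.Propositional using (Unique)
open import Data.Nat using (ℕ; zero; suc; _+_; _*_; _∸_; _^_; _≤_; _<_; _⊓_; z≤n; s≤s; NonZero; >-nonZero)
open import Data.Nat.DivMod
  using (_/_; _%_; m≡m%n+[m/n]*n; m%n<n; m<n*o⇒m/o<n; m<n⇒m%n≡m; +-distrib-/-∣ʳ; m<n⇒m/n≡0; m*n/n≡m)
open import Data.Nat.Divisibility using (_∣_; ∣⇒≤; ∣m+n∣m⇒∣n; n∣m*n)
import Data.Nat.ListAction as List
open import Data.Nat.ListAction.Properties using (sum-++)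
import Data.Nat.Properties as ℕ
open import Data.Nat.Solver using (module +-*-Solver)
open import Data.Product using (Σ-syntax; ∃-syntax; _×_; _,_; proj₁; proj₂)
open import Data.Sum using (inj₁; inj₂; [_,_]′)
import Data.Sum as Sum
open import Data.Sum.Properties using (inj₁-injective; inj₂-injective)
open import Data.Vec using ([]; _∷_; lookup; here; there; tabulate)
open import Data.Vec.Properties using (≡-dec; lookup∘tabulate; lookup⇒[]=; []=⇒lookup)
open import Data.Vec.Functional using (Vector; _++_; replicate)
open import Function using (_∘_; Injective)
import Function.Construct.Composition as Comp
open import Relation.Binary.Definitions using (tri<; tri≈; tri>)
open import Relation.Binary.PropositionalEquality
  using (_≡_; _≢_; refl; sym; trans; cong; cong₂; subst; setoid; module ≡-Reasoning)
open import Relation.Nullary using (Dec; ¬_; does; yes; no; contradiction; ¬?)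
open import Relation.Nullary.Decidable using (dec-true; decidable-stable; _×-dec_; _→-dec_)
open import Relation.Unary using (Pred; Decidable)

open import Algebra.Properties.CommutativeMonoid.Sum ℕ.+-0-commutativeMonoid
  using (sum; sum-syntax; sum-cong-≗; ∑-distrib-+)
open +-*-Solver using (solve; _:+_; _:*_; _:=_; con)

∑-mono-≤ : ∀ {k} {f g : Fin k → ℕ} → (∀ i → f i ≤ g i) → sum f ≤ sum g
∑-mono-≤ {zero} f≤g = z≤n
∑-mono-≤ {suc k} f≤g = ℕ.+-mono-≤ (f≤g zero) (∑-mono-≤ (f≤g ∘ suc))

∑-const : ∀ k x → ∑[ i < k ] x ≡ k * x
∑-const zero x = refl
∑-const (suc k) x = cong (x +_) (∑-const k x)

∑-indicator : ∀ {k} (a : Fin k) x → ∑[ v < k ] (if does (a Fin.≟ v) then x else 0) ≡ x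
∑-indicator {suc k} zero x = trans (cong (x +_) (∑-const k 0)) (trans (cong (x +_) (ℕ.*-zeroʳ k)) (ℕ.+-identityʳ x))
∑-indicator {suc k} (suc a) x = ∑-indicator a x

∑-mono-≤-< : ∀ {k} {f g : Fin k → ℕ} → (∀ j → f j ≤ g j) → ∀ j₀ → f j₀ < g j₀ → sum f < sum g
∑-mono-≤-< f≤g zero f₀<g₀ = ℕ.+-mono-<-≤ f₀<g₀ (∑-mono-≤ (f≤g ∘ suc))
∑-mono-≤-< f≤g (suc j₀) fⱼ<gⱼ = ℕ.+-mono-≤-< (f≤g zero) (∑-mono-≤-< (f≤g ∘ suc) j₀ fⱼ<gⱼ)

injective⇒≤count : ∀ {k c ℓ} {P : Pred (Fin c) ℓ} (P? : Decidable P) {f : Fin k → Fin c} →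
                   Injective _≡_ _≡_ f → (∀ r → P (f r)) → k ≤ length (filter P? (allFin c))
injective⇒≤count {c = c} P? {f} f-inj Pf =
  injective⇒≤ {f = Anyˡ.index ∘ f∈} (f-inj ∘ index-injective (setoid _) (f∈ _) (f∈ _))
  where
  f∈ : ∀ r → f r ∈ˡ filter P? (allFin c)
  f∈ r = ∈-filter⁺ P? (∈-allFin (f r)) (Pf r)

module _ {a ℓ} {A : Set a} {P : Pred A ℓ} (P? : Decidable P) where

  length-filter-∷ : ∀ x xs → length (filter P? xs) ≤ length (filter P? (x ∷ xs))
  length-filter-∷ x xs with does (P? x)
  ... | true  = ℕ.n≤1+n _
  ... | false = ℕ.≤-refl

  length-filter-accept : ∀ {x} xs → P x → length (filter P? xs) < length (filter P? (x ∷ xs))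
  length-filter-accept {x} xs Px with P? x
  ... | yes _  = ℕ.≤-refl
  ... | no ¬Px = contradiction Px ¬Px

length≤∑count : ∀ {a ℓ k} {A : Set a} {P : Fin k → Pred A ℓ} (P? : ∀ j → Decidable (P j)) (xs : List A) →
                (∀ {x} → x ∈ˡ xs → ∃[ j ] P j x) → length xs ≤ ∑[ j < k ] length (filter (P? j) xs)
length≤∑count P? [] _ = z≤n
length≤∑count P? (x ∷ xs) covered with j₀ , Pj₀x ← covered (Anyˡ.here refl) =
  ℕ.≤-<-trans (length≤∑count P? xs (covered ∘ Anyˡ.there))
    (∑-mono-≤-< (λ j → length-filter-∷ (P? j) x xs) j₀ (length-filter-accept (P? j₀) xs Pj₀x))

allPairs-strengthen : ∀ {a p r s} {A : Set a} {P : Pred A p} {R : A → A → Set r} {S : A → A → Set s} {xs} →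
                      (∀ {x y} → P x → P y → R x y → S x y) → All P xs → AllPairs R xs → AllPairs S xs
allPairs-strengthen R⇒S All.[] [] = []
allPairs-strengthen R⇒S (px All.∷ pxs) (Rxs ∷ Rxss) =
  All.zipWith (λ (py , Rxy) → R⇒S px py Rxy) (pxs , Rxs) ∷ allPairs-strengthen R⇒S pxs Rxss

subsetOf : ∀ {n ℓ} {P : Pred (Fin n) ℓ} → Decidable P → Subset n
subsetOf P? = tabulate (does ∘ P?)

module _ {n ℓ} {P : Pred (Fin n) ℓ} (P? : Decidable P) where

  ∈-subsetOf⁺ : ∀ {i} → P i → i ∈ subsetOf P?
  ∈-subsetOf⁺ {i} Pi = lookup⇒[]= i _ (trans (lookup∘tabulate _ i) (dec-true (P? i) Pi))

  ∈-subsetOf⁻ : ∀ {i} → i ∈ subsetOf P? → P i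
  ∈-subsetOf⁻ {i} i∈ with P? i | trans (sym (lookup∘tabulate (does ∘ P?) i)) ([]=⇒lookup i∈)
  ... | yes Pi | _ = Pi

∣p∣≤-injection : ∀ {n t} (p : Subset n) (f : ∀ i → i ∈ p → Fin t) →
                 (∀ {i j} (i∈p : i ∈ p) (j∈p : j ∈ p) → f i i∈p ≡ f j j∈p → i ≡ j) → ∣ p ∣ ≤ t
∣p∣≤-injection [] f f-inj = z≤n
∣p∣≤-injection (outside ∷ p) f f-inj =
  ∣p∣≤-injection p (λ i i∈p → f (suc i) (there i∈p)) (λ i∈p j∈p → suc-injective ∘ f-inj (there i∈p) (there j∈p))
∣p∣≤-injection {t = zero} (inside ∷ p) f f-inj with () ← f zero here
∣p∣≤-injection {t = suc t} (inside ∷ p) f f-inj = s≤s (∣p∣≤-injection p f′ f′-inj)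
  where
  f₀≢f : ∀ {i} (i∈p : i ∈ p) → f zero here ≢ f (suc i) (there i∈p)
  f₀≢f i∈p eq with () ← f-inj here (there i∈p) eq
  f′ : ∀ i → i ∈ p → Fin t
  f′ i i∈p = punchOut (f₀≢f i∈p)
  f′-inj : ∀ {i j} (i∈p : i ∈ p) (j∈p : j ∈ p) → f′ i i∈p ≡ f′ j j∈p → i ≡ j
  f′-inj i∈p j∈p = suc-injective ∘ f-inj (there i∈p) (there j∈p) ∘ punchOut-injective (f₀≢f i∈p) (f₀≢f j∈p)

⊆-extend : ∀ {n k} (p : Subset n) → ∣ p ∣ ≤ k → k ≤ n → ∃[ r ] p ⊆ r × ∣ r ∣ ≡ k
⊆-extend [] _ z≤n = [] , ⊆-refl , refl
⊆-extend (inside ∷ p) (s≤s ∣p∣≤k) (s≤s k≤n) with r , p⊆r , ∣r∣≡k ← ⊆-extend p ∣p∣≤k k≤n =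
  inside ∷ r , s⊆s p⊆r , cong suc ∣r∣≡k
⊆-extend {suc n} {k} (outside ∷ p) ∣p∣≤k k≤1+n with k ℕ.≤? n
... | yes k≤n with r , p⊆r , ∣r∣≡k ← ⊆-extend p ∣p∣≤k k≤n = outside ∷ r , s⊆s p⊆r , ∣r∣≡k
... | no k≰n = ⊤ , ⊆⊤ , trans (∣⊤∣≡n (suc n)) (ℕ.≤-antisym (ℕ.≰⇒> k≰n) k≤1+n)

allSubsets : ∀ n → List (Subset n)
allSubsets zero = [] ∷ []
allSubsets (suc n) = map (inside ∷_) (allSubsets n) ++ˡ map (outside ∷_) (allSubsets n)

∈-allSubsets : ∀ {n} (p : Subset n) → p ∈ˡ allSubsets n
∈-allSubsets [] = Anyˡ.here refl
∈-allSubsets (inside ∷ p) = ∈-++⁺ˡ (∈-map⁺ (inside ∷_) (∈-allSubsets p))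
∈-allSubsets {suc n} (outside ∷ p) = ∈-++⁺ʳ (map (inside ∷_) (allSubsets n)) (∈-map⁺ (outside ∷_) (∈-allSubsets p))

argmax-small-subset : ∀ n t (f : Subset n → ℕ) → ∃[ T ] ∣ T ∣ ≤ t × (∀ S → ∣ S ∣ ≤ t → f S ≤ f T)
argmax-small-subset n t f = T , ∣T∣≤t , T-max
  where
  small? : Decidable (λ (S : Subset n) → ∣ S ∣ ≤ t)
  small? S = ∣ S ∣ ℕ.≤? t
  small : List (Subset n)
  small = filter small? (allSubsets n)
  T : Subset n
  T = argmax f ⊥ small
  ∣T∣≤t : ∣ T ∣ ≤ t
  ∣T∣≤t = argmax-all f (subst (_≤ t) (sym (∣⊥∣≡0 n)) z≤n) (All.all-filter small? (allSubsets n))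
  T-max : ∀ S → ∣ S ∣ ≤ t → f S ≤ f T
  T-max S ∣S∣≤t = All.lookup (f[xs]≤f[argmax] ⊥ small) (∈-filter⁺ small? (∈-allSubsets S) ∣S∣≤t)

residue-window : ∀ w .{{_ : NonZero w}} b {d} → d < w → b % w ≡ (b + d) % w → d ≡ 0
residue-window w b {zero} _ _ = refl
residue-window w b {suc d} d<w residues≡ = contradiction (∣⇒≤ w∣d) (ℕ.<⇒≱ d<w)
  where
  quotients : b / w * w + suc d ≡ (b + suc d) / w * w
  quotients = ℕ.+-cancelˡ-≡ (b % w) _ _ (begin
    b % w + (b / w * w + suc d)         ≡⟨ ℕ.+-assoc (b % w) _ _ ⟨
    b % w + b / w * w + suc d           ≡⟨ cong (_+ suc d) (m≡m%n+[m/n]*n b w) ⟨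
    b + suc d                           ≡⟨ m≡m%n+[m/n]*n (b + suc d) w ⟩
    (b + suc d) % w + (b + suc d) / w * w  ≡⟨ cong (_+ (b + suc d) / w * w) residues≡ ⟨
    b % w + (b + suc d) / w * w         ∎)
    where open ≡-Reasoning
  w∣d : w ∣ suc d
  w∣d = ∣m+n∣m⇒∣n (subst (w ∣_) (sym quotients) (n∣m*n ((b + suc d) / w))) (n∣m*n (b / w))

residue-injective : ∀ w .{{_ : NonZero w}} a {r r′} → r < w → r′ < w → (a + r) % w ≡ (a + r′) % w → r ≡ r′
residue-injective w a {r} {r′} r<w r′<w residues≡ =
  [ (λ r≤r′ → ordered r≤r′ r′<w residues≡) , (λ r′≤r → sym (ordered r′≤r r<w (sym residues≡))) ]′
    (ℕ.≤-total r r′)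
  where
  ordered : ∀ {r r′} → r ≤ r′ → r′ < w → (a + r) % w ≡ (a + r′) % w → r ≡ r′
  ordered {r} {r′} r≤r′ r′<w eq = ℕ.≤-antisym r≤r′ (ℕ.m∸n≡0⇒m≤n (residue-window w (a + r)
    (ℕ.≤-<-trans (ℕ.m∸n≤m r′ r) r′<w)
    (trans eq (cong (_% w) (trans (cong (a +_) (sym (ℕ.m+[n∸m]≡n r≤r′))) (sym (ℕ.+-assoc a r (r′ ∸ r))))))))

divMod-injective : ∀ w .{{_ : NonZero w}} {a b} → a % w ≡ b % w → a / w ≡ b / w → a ≡ b
divMod-injective w {a} {b} %≡ /≡ =
  trans (m≡m%n+[m/n]*n a w) (trans (cong₂ (λ x y → x + y * w) %≡ /≡) (sym (m≡m%n+[m/n]*n b w)))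

Covers : ∀ {n c} → ℕ → Vector (Subset n) c → Fin n → Set
Covers {c = c} k Q i = Σ[ f ∈ (Fin k → Fin c) ] Injective _≡_ _≡_ f × (∀ r → i ∈ Q (f r))

covers-0 : ∀ {n c} {Q : Vector (Subset n) c} {i} → Covers 0 Q i
covers-0 = (λ ()) , (λ {}) , λ ()

covers-replicate : ∀ {n} k {p : Subset n} {i} → i ∈ p → Covers k (replicate k p) i
covers-replicate k i∈p = (λ r → r) , (λ eq → eq) , λ _ → i∈p

⊎-map-injective : ∀ {A B C D : Set} {f : A → B} {g : C → D} →
                Injective _≡_ _≡_ f → Injective _≡_ _≡_ g → Injective _≡_ _≡_ (Sum.map f g)
⊎-map-injective f-inj g-inj {inj₁ _} {inj₁ _} eq = cong inj₁ (f-inj (inj₁-injective eq))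
⊎-map-injective f-inj g-inj {inj₂ _} {inj₂ _} eq = cong inj₂ (g-inj (inj₂-injective eq))

covers-++ : ∀ {n a b k l} {Q : Vector (Subset n) a} {R : Vector (Subset n) b} {i} →
            Covers k Q i → Covers l R i → Covers (k + l) (Q ++ R) i
covers-++ {a = a} {b} {k} {l} {Q} {R} {i} (f , f-inj , f-cov) (g , g-inj , g-cov) = h , h-inj , h-cov
  where
  h : Fin (k + l) → Fin (a + b)
  h = join a b ∘ Sum.map f g ∘ splitAt k
  h-inj : Injective _≡_ _≡_ h
  h-inj = Comp.injective _≡_ _≡_ _≡_ splitAt-injective
            (Comp.injective _≡_ _≡_ _≡_ (⊎-map-injective f-inj g-inj) join-injective)
    where
    splitAt-injective : Injective _≡_ _≡_ (splitAt k {l})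
    splitAt-injective {x} {y} eq = trans (sym (join-splitAt k l x)) (trans (cong (join k l) eq) (join-splitAt k l y))
    join-injective : Injective _≡_ _≡_ (join a b)
    join-injective {x} {y} eq = trans (sym (splitAt-join a b x)) (trans (cong (splitAt a) eq) (splitAt-join a b y))
  h-cov : ∀ r → i ∈ (Q ++ R) (h r)
  h-cov r with splitAt k r
  ... | inj₁ r₁ rewrite splitAt-join a b (inj₁ (f r₁)) = f-cov r₁
  ... | inj₂ r₂ rewrite splitAt-join a b (inj₂ (g r₂)) = g-cov r₂

offset : ∀ {n} → (Fin n → ℕ) → Fin n → ℕ
offset m zero = 0
offset m (suc i) = m zero + offset (m ∘ suc) i

offset+m≤∑ : ∀ {n} (m : Fin n → ℕ) i → offset m i + m i ≤ sum m
offset+m≤∑ m zero = ℕ.m≤m+n (m zero) _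
offset+m≤∑ m (suc i) =
  ℕ.≤-trans (ℕ.≤-reflexive (ℕ.+-assoc (m zero) _ _)) (ℕ.+-monoʳ-≤ (m zero) (offset+m≤∑ (m ∘ suc) i))

offset+m≤offset : ∀ {n} (m : Fin n → ℕ) {i j} → i Fin.< j → offset m i + m i ≤ offset m j
offset+m≤offset m {zero} {suc j} _ = ℕ.m≤m+n (m zero) _
offset+m≤offset m {suc i} {suc j} (s≤s i<j) =
  ℕ.≤-trans (ℕ.≤-reflexive (ℕ.+-assoc (m zero) _ _)) (ℕ.+-monoʳ-≤ (m zero) (offset+m≤offset (m ∘ suc) i<j))

-- Each coordinate i gets m i consecutive cells on the line 0, 1, 2, …; cell p lies in column p mod w and
-- row p div w.  As m i ≤ w, the cells of i lie in distinct columns; as there are at most t·w cells, each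
-- column has t rows, each holding one cell, so it contains at most t coordinates.
module CyclicPacking {n} (w t : ℕ) {{_ : NonZero w}} (m : Fin n → ℕ)
                     (m≤w : ∀ i → m i ≤ w) (∑m≤t*w : sum m ≤ t * w) where

  cell : ∀ i → Fin (m i) → ℕ
  cell i r = offset m i + toℕ r

  cell<cell : ∀ {i j} → i Fin.< j → (r : Fin (m i)) (r′ : Fin (m j)) → cell i r < cell j r′
  cell<cell {i} {j} i<j r r′ = ℕ.<-≤-trans (ℕ.+-monoʳ-< (offset m i) (toℕ<n r))
                                 (ℕ.≤-trans (offset+m≤offset m i<j) (ℕ.m≤m+n (offset m j) (toℕ r′)))

  cell-injective : ∀ {i j} (r : Fin (m i)) (r′ : Fin (m j)) → cell i r ≡ cell j r′ → i ≡ j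
  cell-injective {i} {j} r r′ eq with Fin.<-cmp i j
  ... | tri≈ _ i≡j _ = i≡j
  ... | tri< i<j _ _ = contradiction eq (ℕ.<⇒≢ (cell<cell i<j r r′))
  ... | tri> _ _ j<i = contradiction (sym eq) (ℕ.<⇒≢ (cell<cell j<i r′ r))

  cell<t*w : ∀ i (r : Fin (m i)) → cell i r < t * w
  cell<t*w i r = ℕ.<-≤-trans (ℕ.+-monoʳ-< (offset m i) (toℕ<n r)) (ℕ.≤-trans (offset+m≤∑ m i) ∑m≤t*w)

  columnOf : ∀ i → Fin (m i) → Fin w
  columnOf i r = fromℕ< (m%n<n (cell i r) w)

  rowOf : ∀ i → Fin (m i) → Fin t
  rowOf i r = fromℕ< (m<n*o⇒m/o<n (cell<t*w i r))

  inColumn? : ∀ k i → Dec (∃[ r ] columnOf i r ≡ k)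
  inColumn? k i = Fin.any? (λ r → columnOf i r Fin.≟ k)

  column : Fin w → Subset n
  column k = subsetOf (inColumn? k)

  column-covers : ∀ i → Covers (m i) column i
  column-covers i = columnOf i , columnOf-injective , λ r → ∈-subsetOf⁺ (inColumn? (columnOf i r)) (r , refl)
    where
    columnOf-injective : Injective _≡_ _≡_ (columnOf i)
    columnOf-injective {r} {r′} eq = toℕ-injective (residue-injective w (offset m i)
      (ℕ.<-≤-trans (toℕ<n r) (m≤w i)) (ℕ.<-≤-trans (toℕ<n r′) (m≤w i))
      (trans (sym (toℕ-fromℕ< _)) (trans (cong toℕ eq) (toℕ-fromℕ< _))))

  ∣column∣≤t : ∀ k → ∣ column k ∣ ≤ t
  ∣column∣≤t k = ∣p∣≤-injection (column k) row row-injective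
    where
    witness : ∀ {i} → i ∈ column k → ∃[ r ] columnOf i r ≡ k
    witness = ∈-subsetOf⁻ (inColumn? k)
    row : ∀ i → i ∈ column k → Fin t
    row i i∈ = rowOf i (proj₁ (witness i∈))
    row-injective : ∀ {i j} (i∈ : i ∈ column k) (j∈ : j ∈ column k) → row i i∈ ≡ row j j∈ → i ≡ j
    row-injective i∈ j∈ rows≡ with (r , refl) ← witness i∈ | (r′ , columns≡) ← witness j∈ =
      cell-injective r r′ (divMod-injective w
        (trans (sym (toℕ-fromℕ< _)) (trans (cong toℕ (sym columns≡)) (toℕ-fromℕ< _)))
        (trans (sym (toℕ-fromℕ< _)) (trans (cong toℕ rows≡) (toℕ-fromℕ< _))))

-- A cylinder (x , S) stands for the q ^ ∣ ∁ S ∣ words that agree with x on S.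
module Cylinders (q : ℕ) where

  Cylinder : ℕ → Set
  Cylinder n = Word q n × Subset n

  size : ∀ {n} → Cylinder n → ℕ
  size (_ , S) = q ^ ∣ ∁ S ∣

  totalSize : ∀ {n} → List (Cylinder n) → ℕ
  totalSize = List.sum ∘ map size

  totalSize-++ : ∀ {n} (cs ds : List (Cylinder n)) → totalSize (cs ++ˡ ds) ≡ totalSize cs + totalSize ds
  totalSize-++ cs ds = trans (cong List.sum (map-++ size cs ds)) (sum-++ (map size cs) (map size ds))

  Disjoint : ∀ {n} → Cylinder n → Cylinder n → Set
  Disjoint (x , S) (y , S′) = ∃[ i ] i ∈ S × i ∈ S′ × lookup x i ≢ lookup y i

  slice : ∀ {n} → Fin q → Cylinder (suc n) → List (Cylinder n)
  slice v (a ∷ x , inside ∷ S) = if does (a Fin.≟ v) then [ x , S ] else []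
  slice v (a ∷ x , outside ∷ S) = [ x , S ]

  slices : ∀ {n} → Fin q → List (Cylinder (suc n)) → List (Cylinder n)
  slices v = concatMap (slice v)

  ∑-totalSize-slice : ∀ {n} (c : Cylinder (suc n)) → ∑[ v < q ] totalSize (slice v c) ≡ size c
  ∑-totalSize-slice (a ∷ x , inside ∷ S) = begin
    ∑[ v < q ] totalSize (if does (a Fin.≟ v) then [ x , S ] else [])
      ≡⟨ sum-cong-≗ {q} (λ v → if-float totalSize (does (a Fin.≟ v))) ⟩
    ∑[ v < q ] (if does (a Fin.≟ v) then size (x , S) + 0 else 0)
      ≡⟨ ∑-indicator a _ ⟩
    size (x , S) + 0
      ≡⟨ ℕ.+-identityʳ _ ⟩
    size (x , S) ∎
    where open ≡-Reasoning
  ∑-totalSize-slice (a ∷ x , outside ∷ S) =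
    trans (sum-cong-≗ {q} (λ _ → ℕ.+-identityʳ (size (x , S)))) (∑-const q (size (x , S)))

  ∑-totalSize-slices : ∀ {n} (cs : List (Cylinder (suc n))) → ∑[ v < q ] totalSize (slices v cs) ≡ totalSize cs
  ∑-totalSize-slices [] = trans (∑-const q 0) (ℕ.*-zeroʳ q)
  ∑-totalSize-slices (c ∷ cs) = begin
    ∑[ v < q ] totalSize (slice v c ++ˡ slices v cs)
      ≡⟨ sum-cong-≗ {q} (λ v → totalSize-++ (slice v c) (slices v cs)) ⟩
    ∑[ v < q ] (totalSize (slice v c) + totalSize (slices v cs))
      ≡⟨ ∑-distrib-+ {q} _ _ ⟩
    ∑[ v < q ] totalSize (slice v c) + ∑[ v < q ] totalSize (slices v cs)
      ≡⟨ cong₂ _+_ (∑-totalSize-slice c) (∑-totalSize-slices cs) ⟩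
    size c + totalSize cs ∎
    where open ≡-Reasoning

  restrict : ∀ {n} → Cylinder (suc n) → Cylinder n
  restrict (_ ∷ x , _ ∷ S) = x , S

  Meets : ∀ {n} → Fin q → Cylinder (suc n) → Set
  Meets v (a ∷ _ , b ∷ _) = b ≡ inside → a ≡ v

  ∈-slice⁻ : ∀ {n} v (c : Cylinder (suc n)) {d} → d ∈ˡ slice v c → d ≡ restrict c × Meets v c
  ∈-slice⁻ v (a ∷ x , inside ∷ S) d∈ with a Fin.≟ v | d∈
  ... | yes a≡v | Anyˡ.here refl = refl , λ _ → a≡v
  ∈-slice⁻ v (a ∷ x , outside ∷ S) (Anyˡ.here refl) = refl , λ ()

  allPairs-slice : ∀ {n} {R : Cylinder n → Cylinder n → Set} v (c : Cylinder (suc n)) → AllPairs R (slice v c)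
  allPairs-slice v (a ∷ x , inside ∷ S) with a Fin.≟ v
  ... | yes _ = [] ∷ []
  ... | no _  = []
  allPairs-slice v (a ∷ x , outside ∷ S) = [] ∷ []

  disjoint-restrict : ∀ {n} {v} (c c′ : Cylinder (suc n)) → Meets v c → Meets v c′ →
                      Disjoint c c′ → Disjoint (restrict c) (restrict c′)
  disjoint-restrict (a ∷ x , _) (a′ ∷ x′ , _) meets meets′ (zero , here , here , a≢a′) =
    contradiction (trans (meets refl) (sym (meets′ refl))) a≢a′
  disjoint-restrict (_ ∷ _ , _ ∷ _) (_ ∷ _ , _ ∷ _) _ _ (suc i , there i∈S , there i∈S′ , xᵢ≢x′ᵢ) =
    i , i∈S , i∈S′ , xᵢ≢x′ᵢ

  disjoint-slice : ∀ {n} v {c c′ : Cylinder (suc n)} → Disjoint c c′ →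
                   All (λ d → All (Disjoint d) (slice v c′)) (slice v c)
  disjoint-slice v {c} {c′} c#c′ = All.tabulate λ d∈ → All.tabulate λ d′∈ →
    go (∈-slice⁻ v c d∈) (∈-slice⁻ v c′ d′∈)
    where
    go : ∀ {d d′} → d ≡ restrict c × Meets v c → d′ ≡ restrict c′ × Meets v c′ → Disjoint d d′
    go (refl , meets) (refl , meets′) = disjoint-restrict c c′ meets meets′ c#c′

  allPairs-slices : ∀ {n} v {cs : List (Cylinder (suc n))} → AllPairs Disjoint cs → AllPairs Disjoint (slices v cs)
  allPairs-slices v {cs} disjoint = AllPairs.concat⁺
    (All.map⁺ (All.tabulate {xs = cs} λ {c} _ → allPairs-slice v c))
    (AllPairs.map⁺ (AllPairs.map (λ {c} {c′} → disjoint-slice v {c} {c′}) disjoint))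

  disjoint⇒totalSize≤ : ∀ {n} {cs : List (Cylinder n)} → AllPairs Disjoint cs → totalSize cs ≤ q ^ n
  disjoint⇒totalSize≤ {zero} {[]} _ = z≤n
  disjoint⇒totalSize≤ {zero} {([] , []) ∷ []} _ = ℕ.≤-refl
  disjoint⇒totalSize≤ {zero} {_ ∷ _ ∷ _} (((() , _) ∷ _) ∷ _)
  disjoint⇒totalSize≤ {suc n} {cs} disjoint = begin
    totalSize cs                        ≡⟨ ∑-totalSize-slices cs ⟨
    ∑[ v < q ] totalSize (slices v cs)  ≤⟨ ∑-mono-≤ (λ v → disjoint⇒totalSize≤ (allPairs-slices v disjoint)) ⟩
    ∑[ v < q ] (q ^ n)                  ≡⟨ ∑-const q (q ^ n) ⟩
    q * q ^ n                           ∎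
    where open ℕ.≤-Reasoning

  totalSize-uniform : ∀ {n} (S : Subset n) (xs : List (Word q n)) → totalSize (map (_, S) xs) ≡ length xs * q ^ ∣ ∁ S ∣
  totalSize-uniform S [] = refl
  totalSize-uniform S (x ∷ xs) = cong (q ^ ∣ ∁ S ∣ +_) (totalSize-uniform S xs)

  ∣p∣+∣∁p∣≡n : ∀ {n} (p : Subset n) → ∣ p ∣ + ∣ ∁ p ∣ ≡ n
  ∣p∣+∣∁p∣≡n p = trans (cong (∣ p ∣ +_) (∣∁p∣≡n∸∣p∣ p)) (ℕ.m+[n∸m]≡n (∣p∣≤n p))

  nested-disjoint⇒bound : ∀ {n t} {T L : Subset n} {xs ys : List (Word q n)} .{{_ : NonZero q}} →
                          ∣ T ∣ ≤ t → ∣ L ∣ ≡ suc t →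
                          AllPairs Disjoint (map (_, T) xs ++ˡ map (_, L) ys) →
                          q * length xs + length ys ≤ q ^ suc t
  nested-disjoint⇒bound {n} {t} {T} {L} {xs} {ys} ∣T∣≤t ∣L∣≡1+t disjoint =
    ℕ.*-cancelʳ-≤ (q * length xs + length ys) (q ^ suc t) (q ^ r) {{ℕ.m^n≢0 q r}} (begin
      (q * length xs + length ys) * q ^ r         ≡⟨ solve 4 (λ q a b p → (q :* a :+ b) :* p := a :* (q :* p) :+ b :* p)
                                                         refl q (length xs) (length ys) (q ^ r) ⟩
      length xs * (q * q ^ r) + length ys * q ^ r
        ≤⟨ ℕ.+-monoˡ-≤ _ (ℕ.*-monoʳ-≤ (length xs) (ℕ.^-monoʳ-≤ q 1+r≤∣∁T∣)) ⟩
      length xs * q ^ ∣ ∁ T ∣ + length ys * q ^ r ≡⟨ cong₂ _+_ (totalSize-uniform T xs) (totalSize-uniform L ys) ⟨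
      totalSize (map (_, T) xs) + totalSize (map (_, L) ys) ≡⟨ totalSize-++ (map (_, T) xs) _ ⟨
      totalSize (map (_, T) xs ++ˡ map (_, L) ys)   ≤⟨ disjoint⇒totalSize≤ disjoint ⟩
      q ^ n                                         ≡⟨ cong (q ^_) (∣p∣+∣∁p∣≡n L) ⟨
      q ^ (∣ L ∣ + r)                               ≡⟨ ℕ.^-distribˡ-+-* q ∣ L ∣ r ⟩
      q ^ ∣ L ∣ * q ^ r                             ≡⟨ cong (λ k → q ^ k * q ^ r) ∣L∣≡1+t ⟩
      q ^ suc t * q ^ r                             ∎)
    where
    open ℕ.≤-Reasoning
    r : ℕ
    r = ∣ ∁ L ∣
    1+r≤∣∁T∣ : suc r ≤ ∣ ∁ T ∣
    1+r≤∣∁T∣ = begin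
      suc ∣ ∁ L ∣        ≡⟨ cong suc (∣∁p∣≡n∸∣p∣ L) ⟩
      suc (n ∸ ∣ L ∣)    ≡⟨ cong (λ k → suc (n ∸ k)) ∣L∣≡1+t ⟩
      suc (n ∸ suc t)    ≡⟨ ℕ.+-∸-assoc 1 (subst (_≤ n) ∣L∣≡1+t (∣p∣≤n L)) ⟨
      n ∸ t              ≤⟨ ℕ.∸-monoʳ-≤ n ∣T∣≤t ⟩
      n ∸ ∣ T ∣          ≡⟨ ∣∁p∣≡n∸∣p∣ T ⟨
      ∣ ∁ T ∣            ∎

module Identifiability {q n} (C : List (Word q n)) where

  AgreeOn : Subset n → Word q n → Word q n → Set
  AgreeOn S x y = ∀ i → i ∈ S → lookup x i ≡ lookup y i

  Confusable : Subset n → Word q n → Set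
  Confusable S x = Any (λ y → x ≢ y × AgreeOn S x y) C

  DeterminedOn : Subset n → Word q n → Set
  DeterminedOn S x = ¬ Confusable S x

  agreeOn? : ∀ S x y → Dec (AgreeOn S x y)
  agreeOn? S x y = Fin.all? (λ i → (i ∈? S) →-dec (lookup x i Fin.≟ lookup y i))

  confusable? : ∀ S x → Dec (Confusable S x)
  confusable? S x = Anyˡ.any? (λ y → ¬? (≡-dec Fin._≟_ x y) ×-dec agreeOn? S x y) C

  determinedOn? : ∀ S x → Dec (DeterminedOn S x)
  determinedOn? S x = ¬? (confusable? S x)

  determinedOn : Subset n → List (Word q n)
  determinedOn S = filter (determinedOn? S) C

  determinedOn⇒separated : ∀ {S x y} → DeterminedOn S x → y ∈ˡ C → x ≢ y →
                           ∃[ i ] i ∈ S × lookup x i ≢ lookup y i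
  determinedOn⇒separated {S} {x} {y} determined y∈C x≢y
    with i , ¬agreeᵢ ← Fin.¬∀⟶∃¬ n _ (λ i → (i ∈? S) →-dec (lookup x i Fin.≟ lookup y i))
                         (λ agree → determined (lose y∈C (x≢y , agree)))
    = i , decidable-stable (i ∈? S) (λ i∉S → ¬agreeᵢ (λ i∈S → contradiction i∈S i∉S)) , ¬agreeᵢ ∘ (λ eq _ → eq)

  -- Otherwise the codewords confusing x on the members of Q frame x: at each coordinate at least s of
  -- them agree with x.
  frameproof⇒determinedOn : ∀ {c s} → IsFrameproof c s C → (Q : Vector (Subset n) c) → (∀ i → Covers s Q i) →
                            ∀ {x} → x ∈ˡ C → ∃[ j ] DeterminedOn (Q j) x
  frameproof⇒determinedOn {c} {s} frameproof Q covers {x} x∈C with Fin.any? (λ j → determinedOn? (Q j) x)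
  ... | yes determined = determined
  ... | no undetermined = contradiction (covered≤agreeCount (proj₁ framed)) (ℕ.<⇒≱ (proj₂ framed))
    where
    confuser : ∀ j → ∃[ y ] y ∈ˡ C × (x ≢ y × AgreeOn (Q j) x y)
    confuser j = find (decidable-stable (confusable? (Q j) x) (λ d → undetermined (j , d)))
    ys : Fin c → Word q n
    ys j = proj₁ (confuser j)
    framed : ∃[ i ] agreeCount x ys i < s
    framed = frameproof x x∈C ys (proj₁ ∘ proj₂ ∘ confuser) (proj₁ ∘ proj₂ ∘ proj₂ ∘ confuser)
    covered≤agreeCount : ∀ i → s ≤ agreeCount x ys i
    covered≤agreeCount i with f , f-inj , i∈Qf ← covers i =
      injective⇒≤count _ f-inj (λ r → sym (proj₂ (proj₂ (proj₂ (confuser (f r)))) i (i∈Qf r)))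

  open Cylinders q using (Disjoint)

  determinedOn-disjoint : ∀ {p} {P : Pred (Word q n) p} (P? : Decidable P) S → (∀ {x} → P x → DeterminedOn S x) →
                          Unique C → AllPairs Disjoint (map (_, S) (filter P? C))
  determinedOn-disjoint {P = P} P? S P⇒determined unique = AllPairs.map⁺ (allPairs-strengthen separated
    (All.tabulate (∈-filter⁻ P?)) (AllPairs.filter⁺ P? unique))
    where
    separated : ∀ {x y} → x ∈ˡ C × P x → y ∈ˡ C × P y → x ≢ y → Disjoint (x , S) (y , S)
    separated (_ , Px) (y∈C , _) x≢y with i , i∈S , xᵢ≢yᵢ ← determinedOn⇒separated (P⇒determined Px) y∈C x≢y =
      i , i∈S , i∈S , xᵢ≢yᵢ

module Core {q n s λ′ w t : ℕ} {{_ : NonZero w}} (λ′≤s : λ′ ≤ s) (s≤w : s ≤ w) (w<q : w < q)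
            (sn≡ : s * n ≡ λ′ + t * (λ′ + w))
            (C : List (Word q n)) (unique : Unique C) (frameproof : IsFrameproof (λ′ + w) s C)
            (T L : Subset n) (T⊆L : T ⊆ L) (∣T∣≤t : ∣ T ∣ ≤ t) (∣L∣≡1+t : ∣ L ∣ ≡ suc t)
            (T-max : ∀ S → ∣ S ∣ ≤ t → length (Identifiability.determinedOn C S) ≤ length (Identifiability.determinedOn C T))
            where

  open Identifiability C
  open Cylinders q

  -- A coordinate of L is covered λ′ times by the copies of L and needs s ∸ λ′ more from the columns;
  -- any other coordinate needs all s from the columns.
  copies demand : Side → ℕ
  copies inside  = λ′
  copies outside = 0
  demand inside  = s ∸ λ′
  demand outside = s

  copies+demand≡s : ∀ b → copies b + demand b ≡ s
  copies+demand≡s inside  = ℕ.m+[n∸m]≡n λ′≤s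
  copies+demand≡s outside = refl

  demand≤w : ∀ b → demand b ≤ w
  demand≤w inside  = ℕ.≤-trans (ℕ.m∸n≤m s λ′) s≤w
  demand≤w outside = s≤w

  ∑demand+λ′∣p∣≡s*k : ∀ {k} (p : Subset k) → ∑[ i < k ] demand (lookup p i) + λ′ * ∣ p ∣ ≡ s * k
  ∑demand+λ′∣p∣≡s*k [] = trans (ℕ.*-zeroʳ λ′) (sym (ℕ.*-zeroʳ s))
  ∑demand+λ′∣p∣≡s*k {suc k} (inside ∷ p) = begin
    (s ∸ λ′ + ∑[ i < k ] demand (lookup p i)) + λ′ * suc ∣ p ∣
      ≡⟨ solve 4 (λ d σ l z → (d :+ σ) :+ l :* (con 1 :+ z) := (d :+ l) :+ (σ :+ l :* z)) refl (s ∸ λ′) _ λ′ ∣ p ∣ ⟩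
    (s ∸ λ′ + λ′) + (∑[ i < k ] demand (lookup p i) + λ′ * ∣ p ∣)
      ≡⟨ cong₂ _+_ (ℕ.m∸n+n≡m λ′≤s) (∑demand+λ′∣p∣≡s*k p) ⟩
    s + s * k
      ≡⟨ ℕ.*-suc s k ⟨
    s * suc k ∎
    where open ≡-Reasoning
  ∑demand+λ′∣p∣≡s*k {suc k} (outside ∷ p) =
    trans (ℕ.+-assoc s _ _) (trans (cong (s +_) (∑demand+λ′∣p∣≡s*k p)) (sym (ℕ.*-suc s k)))

  ∑demand≡t*w : ∑[ i < n ] demand (lookup L i) ≡ t * w
  ∑demand≡t*w = ℕ.+-cancelʳ-≡ (λ′ * suc t) _ _ (begin
    ∑[ i < n ] demand (lookup L i) + λ′ * suc t  ≡⟨ cong (λ k → ∑[ i < n ] demand (lookup L i) + λ′ * k) ∣L∣≡1+t ⟨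
    ∑[ i < n ] demand (lookup L i) + λ′ * ∣ L ∣  ≡⟨ ∑demand+λ′∣p∣≡s*k L ⟩
    s * n                                        ≡⟨ sn≡ ⟩
    λ′ + t * (λ′ + w)                            ≡⟨ solve 3 (λ l t w → l :+ t :* (l :+ w) := t :* w :+ l :* (con 1 :+ t))
                                                            refl λ′ t w ⟩
    t * w + λ′ * suc t                           ∎)
    where open ≡-Reasoning

  open CyclicPacking w t (demand ∘ lookup L) (demand≤w ∘ lookup L) (ℕ.≤-reflexive ∑demand≡t*w)

  frame : Vector (Subset n) (λ′ + w)
  frame = replicate λ′ L ++ column

  frame-covers : ∀ i → Covers s frame i
  frame-covers i = subst (λ k → Covers k frame i) (copies+demand≡s (lookup L i)) (covers-++ copies-covers (column-covers i))
    where
    copies-covers : Covers (copies (lookup L i)) (replicate λ′ L) i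
    copies-covers with lookup L i in i∈L
    ... | inside  = covers-replicate λ′ (lookup⇒[]= i L i∈L)
    ... | outside = covers-0

  NewlyDetermined : Word q n → Set
  NewlyDetermined x = ¬ DeterminedOn T x × DeterminedOn L x

  newlyDetermined? : Decidable NewlyDetermined
  newlyDetermined? x = ¬? (determinedOn? T x) ×-dec determinedOn? L x

  Kind : Fin (2 + w) → Word q n → Set
  Kind zero          = DeterminedOn T
  Kind (suc zero)    = NewlyDetermined
  Kind (suc (suc k)) = DeterminedOn (column k)

  kind? : ∀ j → Decidable (Kind j)
  kind? zero          = determinedOn? T
  kind? (suc zero)    = newlyDetermined?
  kind? (suc (suc k)) = determinedOn? (column k)

  every-kind : ∀ {x} → x ∈ˡ C → ∃[ j ] Kind j x
  every-kind {x} x∈C with j , determined ← frameproof⇒determinedOn frameproof frame frame-covers x∈C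
                     with splitAt λ′ j
  ... | inj₂ k = suc (suc k) , determined
  ... | inj₁ _ with determinedOn? T x
  ...   | yes onT = zero , onT
  ...   | no ¬onT = suc zero , ¬onT , determined

  columns-bound : ∑[ k < w ] length (determinedOn (column k)) ≤ w * length (determinedOn T)
  columns-bound = ℕ.≤-trans (∑-mono-≤ (λ k → T-max (column k) (∣column∣≤t k))) (ℕ.≤-reflexive (∑-const w _))

  onT onL : List (Word q n)
  onT = determinedOn T
  onL = filter newlyDetermined? C

  cylinders-disjoint : AllPairs Disjoint (map (_, T) onT ++ˡ map (_, L) onL)
  cylinders-disjoint = AllPairs.++⁺ (determinedOn-disjoint (determinedOn? T) T (λ onT → onT) unique)
                                    (determinedOn-disjoint newlyDetermined? L proj₂ unique)
                                    (All.map⁺ (All.tabulate λ x∈ → All.map⁺ (All.tabulate λ y∈ → across x∈ y∈)))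
    where
    across : ∀ {x y} → x ∈ˡ onT → y ∈ˡ onL → Disjoint (x , T) (y , L)
    across x∈ y∈ with _ , x-onT ← ∈-filter⁻ (determinedOn? T) {xs = C} x∈
                    | y∈C , y-off-T , _ ← ∈-filter⁻ newlyDetermined? {xs = C} y∈
      with i , i∈T , xᵢ≢yᵢ ← determinedOn⇒separated x-onT y∈C (λ { refl → y-off-T x-onT }) =
      i , i∈T , T⊆L i∈T , xᵢ≢yᵢ

  length≤q^[1+t] : length C ≤ q ^ suc t
  length≤q^[1+t] = begin
    length C
      ≤⟨ length≤∑count {P = Kind} kind? C every-kind ⟩
    length onT + (length onL + ∑[ k < w ] length (determinedOn (column k)))
      ≤⟨ ℕ.+-monoʳ-≤ (length onT) (ℕ.+-monoʳ-≤ (length onL) columns-bound) ⟩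
    length onT + (length onL + w * length onT)
      ≡⟨ solve 3 (λ a b w → a :+ (b :+ w :* a) := (con 1 :+ w) :* a :+ b) refl (length onT) (length onL) w ⟩
    suc w * length onT + length onL
      ≤⟨ ℕ.+-monoˡ-≤ (length onL) (ℕ.*-monoˡ-≤ (length onT) w<q) ⟩
    q * length onT + length onL
      ≤⟨ nested-disjoint⇒bound {T = T} {L} {onT} {onL} {{>-nonZero (ℕ.<-≤-trans (s≤s z≤n) w<q)}}
           ∣T∣≤t ∣L∣≡1+t cylinders-disjoint ⟩
    q ^ suc t
      ∎
    where open ℕ.≤-Reasoning

frameproof-bound : ∀ {q n s λ′ w t} {{_ : NonZero w}} → λ′ ≤ s → s ≤ w → w < q → t < n →
                   s * n ≡ λ′ + t * (λ′ + w) →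
                   (C : List (Word q n)) → Unique C → IsFrameproof (λ′ + w) s C → length C ≤ q ^ suc t
frameproof-bound {q} {n} {s} {λ′} {w} {t} λ′≤s s≤w w<q t<n sn≡ C unique frameproof =
  viaMaximiser (argmax-small-subset n t (length ∘ determinedOn))
  where
  open Identifiability C
  viaMaximiser : ∃[ T ] ∣ T ∣ ≤ t × (∀ S → ∣ S ∣ ≤ t → length (determinedOn S) ≤ length (determinedOn T)) →
                 length C ≤ q ^ suc t
  viaMaximiser (T , ∣T∣≤t , T-max) = viaExtension (⊆-extend T (ℕ.m≤n⇒m≤1+n ∣T∣≤t) t<n)
    where
    viaExtension : ∃[ L ] T ⊆ L × ∣ L ∣ ≡ suc t → length C ≤ q ^ suc t
    viaExtension (L , T⊆L , ∣L∣≡1+t) =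
      Core.length≤q^[1+t] λ′≤s s≤w w<q sn≡ C unique frameproof T L T⊆L ∣T∣≤t ∣L∣≡1+t T-max

m≡r+[m/c]*c : ∀ {r c} m .{{_ : NonZero c}} → r < c → r % c ≡ m % c → m ≡ r + m / c * c
m≡r+[m/c]*c {r} {c} m r<c residues≡ = trans (m≡m%n+[m/n]*n m c) (cong (_+ m / c * c) (trans (sym residues≡) (m<n⇒m%n≡m r<c)))

[r+k*c+[c∸1]]/c≡1+k : ∀ {r c} k .{{_ : NonZero c}} → 1 ≤ r → r < c → (r + k * c + (c ∸ 1)) / c ≡ suc k
[r+k*c+[c∸1]]/c≡1+k {suc r} {suc c} k _ 1+r<1+c = begin
  (suc r + k * suc c + c) / suc c    ≡⟨ cong (_/ suc c) (solve 3 (λ r k c →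
                                          con 1 :+ r :+ k :* (con 1 :+ c) :+ c := r :+ (con 1 :+ k) :* (con 1 :+ c))
                                          refl r k c) ⟩
  (r + suc k * suc c) / suc c        ≡⟨ +-distrib-/-∣ʳ r (n∣m*n (suc k)) ⟩
  r / suc c + suc k * suc c / suc c  ≡⟨ cong₂ _+_ (m<n⇒m/n≡0 (ℕ.<-trans (ℕ.n<1+n r) 1+r<1+c)) (m*n/n≡m (suc k) (suc c)) ⟩
  suc k                              ∎
  where open ≡-Reasoning

m*n/c<n : ∀ {m c n} .{{_ : NonZero c}} → 1 ≤ n → m < c → m * n / c < n
m*n/c<n {m} {c} {n} 1≤n m<c =
  m<n*o⇒m/o<n (ℕ.<-≤-trans (ℕ.*-monoˡ-< n {{>-nonZero 1≤n}} m<c) (ℕ.≤-reflexive (ℕ.*-comm c n)))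

theorem3p3 : (c s n λ' q : ℕ) → .{{_ : NonZero c}} →
    2 ≤ c → 1 ≤ s → s ≤ c ∸ 1 → 1 ≤ n →
    λ' % c ≡ (s * n) % c → 1 ≤ λ' → λ' ≤ s ⊓ (c ∸ s) →
    c ∸ λ' < q →
    (C : List (Word q n)) → Unique C → IsFrameproof c s C →
    length C ≤ q ^ ((s * n + (c ∸ 1)) / c)
theorem3p3 c s n λ′ q 2≤c 1≤s s≤c∸1 1≤n residues≡ 1≤λ′ λ′≤s⊓[c∸s] c∸λ′<q C unique frameproof =
  subst (λ e → length C ≤ q ^ e) (sym ⌈sn/c⌉≡1+t)
    (frameproof-bound {{>-nonZero (ℕ.≤-trans 1≤s s≤w)}} λ′≤s s≤w c∸λ′<q (m*n/c<n 1≤n s<c)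
       (subst (λ c → s * n ≡ λ′ + t * c) (sym λ′+w≡c) sn≡λ′+t*c) C unique
       (subst (λ c → IsFrameproof c s C) (sym λ′+w≡c) frameproof))
  where
  t w : ℕ
  t = s * n / c
  w = c ∸ λ′
  s<c : s < c
  s<c = ℕ.≤-<-trans s≤c∸1 (ℕ.∸-monoʳ-< {c} (s≤s z≤n) (ℕ.≤-trans (s≤s z≤n) 2≤c))
  λ′≤s : λ′ ≤ s
  λ′≤s = ℕ.≤-trans λ′≤s⊓[c∸s] (ℕ.m⊓n≤m s (c ∸ s))
  s≤w : s ≤ w
  s≤w = ℕ.m+n≤o⇒m≤o∸n s (ℕ.≤-trans (ℕ.≤-reflexive (ℕ.+-comm s λ′))
          (ℕ.m≤o∸n⇒m+n≤o λ′ (ℕ.<⇒≤ s<c) (ℕ.≤-trans λ′≤s⊓[c∸s] (ℕ.m⊓n≤n s (c ∸ s)))))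
  λ′<c : λ′ < c
  λ′<c = ℕ.≤-<-trans λ′≤s s<c
  λ′+w≡c : λ′ + w ≡ c
  λ′+w≡c = ℕ.m+[n∸m]≡n (ℕ.<⇒≤ λ′<c)
  sn≡λ′+t*c : s * n ≡ λ′ + t * c
  sn≡λ′+t*c = m≡r+[m/c]*c (s * n) λ′<c residues≡
  ⌈sn/c⌉≡1+t : (s * n + (c ∸ 1)) / c ≡ suc t
  ⌈sn/c⌉≡1+t = trans (cong (λ m → (m + (c ∸ 1)) / c) sn≡λ′+t*c) ([r+k*c+[c∸1]]/c≡1+k t 1≤λ′ λ′<c)
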